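{- For all $\alpha,\beta\in\vartheta(\varepsilon_{\Omega+1})$, if $f(\alpha)\trianglelefteq f(\beta)$ holds in $T_2$, then $\alpha\preceq\beta$.
   Context: Terms $\vartheta(\varepsilon_{\Omega+1})$, relation $\prec$ and finite sets $E(\alpha)$ are defined by simultaneous recursion (on term length $l$, where $l(\Omega)=0$, $l(\vartheta\alpha)=l(\alpha)+1$, $l(\langle\alpha_0,\dots,\alpha_{n-1}\rangle)=n+\sum_i l(\alpha_i)$): Terms: $\Omega$; $\vartheta\alpha$ for every term $\alpha$; $\langle\alpha_0,\dots,\alpha_{n-1}\rangle$ ($n\ge0$) for terms $\alpha_i$, provided that if $n>1$ then $\alpha_{n-1}\preceq\dots\preceq\alpha_0$ ($\preceq$ meaning $\prec$ or syntactic equality), and if $n=1$ then $\alpha_0$ is not of the form $\Omega$ or $\vartheta\beta$. $E(\Omega)=\emptyset$, $E(\vartheta\alpha)=\{\vartheta\alpha\}$, $E(\langle\alpha_0,\dots,\alpha_{n-1}\rangle)=\bigcup_{i<n}E(\alpha_i)$. $\alpha\prec\beta$ holds iff: (1) $\alpha=\Omega$ and $\beta=\langle\beta_0,\dots,\beta_{n-1}\rangle$ with $n>0$, $\Omega\preceq\beta_0$; or (2) $\alpha=\vartheta\alpha'$ and one of: $\beta=\Omega$; $\beta=\langle\beta_0,\dots,\beta_{n-1}\rangle$ with $n>0$, $\alpha\preceq\beta_0$; $\beta=\vartheta\beta'$ with $\alpha'\prec\beta'$ and $\gamma\prec\beta$ for all $\gamma\in E(\alpha')$; $\beta=\vartheta\beta'$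 with $\alpha\preceq\gamma$ for some $\gamma\in E(\beta')$; or (3) $\alpha=\langle\alpha_0,\dots,\alpha_{m-1}\rangle$ and one of: $\beta$ is $\Omega$ or some $\vartheta\beta'$, and $m=0$ or $\alpha_0\prec\beta$; $\beta=\langle\beta_0,\dots,\beta_{n-1}\rangle$ and for some $j\le\min(m,n)$, $\alpha_i=\beta_i$ for all $i<j$ and either $j=m<n$ or ($j<\min(m,n)$ and $\alpha_j\prec\beta_j$). $T_2$ is generated by: for a finite multiset $\sigma=[t_0,\dots,t_{k-1}]$ ($k\ge0$) of already constructed elements and $n\in\{0,1\}$, $n\star\sigma\in T_2$; $r(n\star\sigma)=n$. For a relation $\le$, $[x_0,\dots,x_{k-1}]\le^M[y_0,\dots,y_{m-1}]$ iff there is an injection $g$ with $x_i\le y_{g(i)}$ for all $i<k$. Recursively, $s\trianglelefteq t$ iff $s=m\star\sigma$, $t=n\star\tau$ with $m=n$ and $\sigma\trianglelefteq^M\tau$, or $t=n\star[t_0,\dots,t_{k-1}]$ with $r(s)\le n$ and $s\trianglelefteq t_i$ for some $i<k$. The map $f:\vartheta(\varepsilon_{\Omega+1})\to T_2$ is defined by $f(\Omega)=1\star[]$, $f(\vartheta\alpha)=0\star[1\star[f(\alpha)]]$, and $f(\langle\alpha_0,\dots,\alpha_{n-1}\rangle)=i\star[f(\alpha_0),\dots,f(\alpha_{n-1})]$ where $i=0$ if $n=0$ or $\alpha_0\prec\Omega$, and $i=1$ otherwise. -}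

module Defs where

open import Data.Nat using (ℕ)
open import Data.Fin using (Fin; zero; suc) renaming (_≤_ to _≤ᶠ_)
open import Data.List using (List; []; _∷_; [_]; _++_; length; lookup)
open import Data.List.Relation.Unary.All using (All)
open import Data.List.Relation.Unary.Any using (Any)
open import Data.List.Relation.Unary.Linked using (Linked)
open import Data.Unit using (⊤)
open import Relation.Binary.PropositionalEquality using (_≡_)
open import Relation.Nullary using (Dec; yes; no)
open import Function.Definitions using (Injective)

data Term : Set where
  Ω   : Term
  ϑ   : Term → Term
  ⟨_⟩ : List Term → Term

mutual
  E : Term → List Term
  E Ω = []
  E (ϑ a) = [ ϑ a ]
  E ⟨ as ⟩ = Es as

  Es : List Term → List Term
  Es [] = []
  Es (a ∷ as) = E a ++ Es as

-- The order ≺ (inductive relation, equivalent to the recursion on length)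
mutual
  data _⪯_ : Term → Term → Set where
    lt : ∀ {a b} → a ≺ b → a ⪯ b
    eq : ∀ {a} → a ⪯ a

  data _≺_ : Term → Term → Set where
    Ω≺⟨⟩   : ∀ {b bs} → Ω ⪯ b → Ω ≺ ⟨ b ∷ bs ⟩
    ϑ≺Ω    : ∀ {a} → ϑ a ≺ Ω
    ϑ≺⟨⟩   : ∀ {a b bs} → ϑ a ⪯ b → ϑ a ≺ ⟨ b ∷ bs ⟩
    ϑ≺ϑ₁   : ∀ {a b} → a ≺ b → All (λ g → g ≺ ϑ b) (E a) → ϑ a ≺ ϑ b
    ϑ≺ϑ₂   : ∀ {a b} → Any (λ g → ϑ a ⪯ g) (E b) → ϑ a ≺ ϑ b
    []≺Ω   : ⟨ [] ⟩ ≺ Ω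
    ∷≺Ω    : ∀ {a as} → a ≺ Ω → ⟨ a ∷ as ⟩ ≺ Ω
    []≺ϑ   : ∀ {b} → ⟨ [] ⟩ ≺ ϑ b
    ∷≺ϑ    : ∀ {a as b} → a ≺ ϑ b → ⟨ a ∷ as ⟩ ≺ ϑ b
    ⟨⟩≺⟨⟩  : ∀ {as bs} → Lex as bs → ⟨ as ⟩ ≺ ⟨ bs ⟩

  data Lex : List Term → List Term → Set where
    prefix : ∀ {b bs} → Lex [] (b ∷ bs)
    here   : ∀ {a as b bs} → a ≺ b → Lex (a ∷ as) (b ∷ bs)
    there  : ∀ {a as bs} → Lex as bs → Lex (a ∷ as) (a ∷ bs)

-- Side condition for n = 1: α₀ is not Ω nor of the form ϑβ
data NotPrincipal : Term → Set where
  isList : ∀ {as} → NotPrincipal ⟨ as ⟩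

SingletonOK : List Term → Set
SingletonOK (a ∷ []) = NotPrincipal a
SingletonOK _ = ⊤

data WF : Term → Set where
  wfΩ : WF Ω
  wfϑ : ∀ {a} → WF a → WF (ϑ a)
  wf⟨⟩ : ∀ {as} → All WF as → Linked (λ x y → y ⪯ x) as → SingletonOK as → WF ⟨ as ⟩

_≺Ω? : (a : Term) → Dec (a ≺ Ω)
Ω ≺Ω? = no (λ ())
ϑ a ≺Ω? = yes ϑ≺Ω
⟨ [] ⟩ ≺Ω? = yes []≺Ω
⟨ a ∷ as ⟩ ≺Ω? with a ≺Ω?
... | yes p = yes (∷≺Ω p)
... | no ¬p = no (λ { (∷≺Ω p) → ¬p p })

-- T₂: elements n ⋆ σ with n ∈ {0,1} and σ a finite multiset (a list,
-- considered up to permutation; ⊴ below is permutation invariant)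

data T2 : Set where
  _⋆_ : Fin 2 → List T2 → T2

r : T2 → Fin 2
r (n ⋆ _) = n

mutual
  data _⊴_ : T2 → T2 → Set where
    ⊴-node : ∀ {m n σ τ} → m ≡ n → σ ⊴ᴹ τ → (m ⋆ σ) ⊴ (n ⋆ τ)
    ⊴-sub  : ∀ {s n ts} → r s ≤ᶠ n → Any (s ⊴_) ts → s ⊴ (n ⋆ ts)

  data _⊴ᴹ_ : List T2 → List T2 → Set where
    inj : ∀ {σ τ} (g : Fin (length σ) → Fin (length τ)) →
          Injective _≡_ _≡_ g →
          (∀ i → lookup σ i ⊴ lookup τ (g i)) → σ ⊴ᴹ τ

mutual
  f : Term → T2
  f Ω = suc zero ⋆ []
  f (ϑ a) = zero ⋆ (suc zero ⋆ (f a ∷ []) ∷ [])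
  f ⟨ [] ⟩ = zero ⋆ []
  f ⟨ a ∷ as ⟩ with a ≺Ω?
  ... | yes _ = zero ⋆ (f a ∷ fs as)
  ... | no _  = suc zero ⋆ (f a ∷ fs as)

  fs : List Term → List T2
  fs [] = []
  fs (a ∷ as) = f a ∷ fs as

-- The argument is an induction on l(α) + l(β). The label r (f α) is 0 exactly when α ≺ Ω,
-- and labels cannot decrease along ⊴. Since f ⟨ β₀ , … ⟩ for a list term below Ω only has
-- children of label 0, the label-1 node inside f (ϑ α') cannot be matched within such a list;
-- so an embedding of f (ϑ α') into f β passes through f γ for some γ ∈ E(β), which yields the
-- clauses of ≺ for ϑ-terms. A node embedding of two list terms is an injection between their
-- descending components, which forces the lexicographic order. Finally, f (ϑ β') ⊴ f β' is
-- impossible for height reasons, which separates ϑ α' ≺ ϑ β' from equality.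

module Submission where

open import Defs
open import Data.Nat using (ℕ; zero; suc; _+_; _≤_; _<_; _⊔_; s≤s; z≤n)
open import Data.Nat.Properties
  using (≤-refl; ≤-trans; <-≤-trans; <⇒≤; n≤1+n; m≤m+n; m≤n+m; m≤m⊔n; m≤n⊔m; ⊔-lub; <⇒≱;
         +-mono-<; +-monoˡ-<; +-monoʳ-<; +-monoˡ-≤; n<1+n)
open import Data.Nat.Induction using (<-wellFounded)
open import Induction.WellFounded using (Acc; acc)
open import Data.Fin using (Fin; zero; suc) renaming (_≤_ to _≤ᶠ_)
open import Data.Fin.Properties using (suc-injective; ≤fromℕ; 0≢1+n)
  renaming (≤-refl to ≤ᶠ-refl; ≤-trans to ≤ᶠ-trans; ≤-reflexive to ≤ᶠ-reflexive)
open import Data.List using (List; []; _∷_; [_]; length; lookup)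
open import Data.List.Relation.Unary.All as All using (All; []; _∷_)
open import Data.List.Relation.Unary.Any using (Any; here; there; index)
open import Data.List.Relation.Unary.Any.Properties using (++⁺ˡ; ++⁺ʳ; lookup-index; singleton⁻)
open import Data.List.Relation.Unary.Linked using (Linked; _∷_; tail)
open import Data.List.Membership.Propositional using (_∈_; find; lose)
open import Data.List.Membership.Propositional.Properties using (∈-++⁻; ∈-lookup)
open import Data.Product using (_×_; _,_; ∃-syntax)
open import Data.Sum using (_⊎_; inj₁; inj₂)
open import Data.Empty using (⊥-elim)
open import Function using (_∘_; id)
open import Function.Definitions using (Injective)
open import Relation.Binary.PropositionalEquality using (_≡_; _≢_; refl; sym; cong; subst; subst₂)
open import Relation.Nullary using (¬_; yes; no)

mutual
  ≺-trans : ∀ {x y z} → x ≺ y → y ≺ z → x ≺ z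
  ≺-trans (Ω≺⟨⟩ p) (∷≺Ω q) = ⪯-≺-trans p q
  ≺-trans (Ω≺⟨⟩ p) (∷≺ϑ q) = ⪯-≺-trans p q
  ≺-trans (Ω≺⟨⟩ p) (⟨⟩≺⟨⟩ (here q)) = Ω≺⟨⟩ (lt (⪯-≺-trans p q))
  ≺-trans (Ω≺⟨⟩ p) (⟨⟩≺⟨⟩ (there _)) = Ω≺⟨⟩ p
  ≺-trans ϑ≺Ω (Ω≺⟨⟩ q) = ϑ≺⟨⟩ (lt (≺-⪯-trans ϑ≺Ω q))
  ≺-trans (ϑ≺⟨⟩ _) (∷≺Ω _) = ϑ≺Ω
  ≺-trans (ϑ≺⟨⟩ p) (∷≺ϑ q) = ⪯-≺-trans p q
  ≺-trans (ϑ≺⟨⟩ p) (⟨⟩≺⟨⟩ (here q)) = ϑ≺⟨⟩ (lt (⪯-≺-trans p q))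
  ≺-trans (ϑ≺⟨⟩ p) (⟨⟩≺⟨⟩ (there _)) = ϑ≺⟨⟩ p
  ≺-trans (ϑ≺ϑ₁ _ _) ϑ≺Ω = ϑ≺Ω
  ≺-trans (ϑ≺ϑ₂ _) ϑ≺Ω = ϑ≺Ω
  ≺-trans p@(ϑ≺ϑ₁ _ _) (ϑ≺⟨⟩ q) = ϑ≺⟨⟩ (lt (≺-⪯-trans p q))
  ≺-trans p@(ϑ≺ϑ₂ _) (ϑ≺⟨⟩ q) = ϑ≺⟨⟩ (lt (≺-⪯-trans p q))
  ≺-trans p@(ϑ≺ϑ₁ _ _) (ϑ≺ϑ₂ Q) = ϑ≺ϑ₂ (≺-⪯-trans-Any p Q)
  ≺-trans p@(ϑ≺ϑ₂ _) (ϑ≺ϑ₂ Q) = ϑ≺ϑ₂ (≺-⪯-trans-Any p Q)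
  ≺-trans (ϑ≺ϑ₁ p P) q@(ϑ≺ϑ₁ q′ _) = ϑ≺ϑ₁ (≺-trans p q′) (≺-trans-All P q)
  ≺-trans (ϑ≺ϑ₂ P) (ϑ≺ϑ₁ _ Q) = ⪯-≺-trans-Any-All P Q
  ≺-trans []≺Ω (Ω≺⟨⟩ _) = ⟨⟩≺⟨⟩ prefix
  ≺-trans (∷≺Ω p) (Ω≺⟨⟩ q) = ⟨⟩≺⟨⟩ (here (≺-⪯-trans p q))
  ≺-trans []≺ϑ ϑ≺Ω = []≺Ω
  ≺-trans []≺ϑ (ϑ≺⟨⟩ _) = ⟨⟩≺⟨⟩ prefix
  ≺-trans []≺ϑ (ϑ≺ϑ₁ _ _) = []≺ϑ
  ≺-trans []≺ϑ (ϑ≺ϑ₂ _) = []≺ϑ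
  ≺-trans (∷≺ϑ p) q@ϑ≺Ω = ∷≺Ω (≺-trans p q)
  ≺-trans (∷≺ϑ p) (ϑ≺⟨⟩ q) = ⟨⟩≺⟨⟩ (here (≺-⪯-trans p q))
  ≺-trans (∷≺ϑ p) q@(ϑ≺ϑ₁ _ _) = ∷≺ϑ (≺-trans p q)
  ≺-trans (∷≺ϑ p) q@(ϑ≺ϑ₂ _) = ∷≺ϑ (≺-trans p q)
  ≺-trans (⟨⟩≺⟨⟩ prefix) (∷≺Ω _) = []≺Ω
  ≺-trans (⟨⟩≺⟨⟩ (here p)) (∷≺Ω q) = ∷≺Ω (≺-trans p q)
  ≺-trans (⟨⟩≺⟨⟩ (there _)) (∷≺Ω q) = ∷≺Ω q
  ≺-trans (⟨⟩≺⟨⟩ prefix) (∷≺ϑ _) = []≺ϑ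
  ≺-trans (⟨⟩≺⟨⟩ (here p)) (∷≺ϑ q) = ∷≺ϑ (≺-trans p q)
  ≺-trans (⟨⟩≺⟨⟩ (there _)) (∷≺ϑ q) = ∷≺ϑ q
  ≺-trans (⟨⟩≺⟨⟩ p) (⟨⟩≺⟨⟩ q) = ⟨⟩≺⟨⟩ (Lex-trans p q)

  Lex-trans : ∀ {as bs cs} → Lex as bs → Lex bs cs → Lex as cs
  Lex-trans prefix (here _) = prefix
  Lex-trans prefix (there _) = prefix
  Lex-trans (here p) (here q) = here (≺-trans p q)
  Lex-trans (here p) (there _) = here p
  Lex-trans (there _) (here q) = here q
  Lex-trans (there p) (there q) = there (Lex-trans p q)

  ⪯-≺-trans : ∀ {x y z} → x ⪯ y → y ≺ z → x ≺ z
  ⪯-≺-trans eq q = q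
  ⪯-≺-trans (lt p) q = ≺-trans p q

  ≺-⪯-trans : ∀ {x y z} → x ≺ y → y ⪯ z → x ≺ z
  ≺-⪯-trans p eq = p
  ≺-⪯-trans p (lt q) = ≺-trans p q

  ≺-⪯-trans-Any : ∀ {x y gs} → x ≺ y → Any (y ⪯_) gs → Any (x ⪯_) gs
  ≺-⪯-trans-Any p (here q) = here (lt (≺-⪯-trans p q))
  ≺-⪯-trans-Any p (there Q) = there (≺-⪯-trans-Any p Q)

  ≺-trans-All : ∀ {y z gs} → All (_≺ y) gs → y ≺ z → All (_≺ z) gs
  ≺-trans-All [] q = []
  ≺-trans-All (p ∷ P) q = ≺-trans p q ∷ ≺-trans-All P q

  ⪯-≺-trans-Any-All : ∀ {x z gs} → Any (x ⪯_) gs → All (_≺ z) gs → x ≺ z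
  ⪯-≺-trans-Any-All (here p) (q ∷ _) = ⪯-≺-trans p q
  ⪯-≺-trans-Any-All (there P) (_ ∷ Q) = ⪯-≺-trans-Any-All P Q

⪯-trans : ∀ {x y z} → x ⪯ y → y ⪯ z → x ⪯ z
⪯-trans eq q = q
⪯-trans (lt p) q = lt (≺-⪯-trans p q)

⟨⟩-least : ∀ x → ⟨ [] ⟩ ⪯ x
⟨⟩-least Ω = lt []≺Ω
⟨⟩-least (ϑ _) = lt []≺ϑ
⟨⟩-least ⟨ [] ⟩ = eq
⟨⟩-least ⟨ _ ∷ _ ⟩ = lt (⟨⟩≺⟨⟩ prefix)

head≺⟨∷⟩ : ∀ a as → a ≺ ⟨ a ∷ as ⟩
head≺⟨∷⟩ Ω _ = Ω≺⟨⟩ eq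
head≺⟨∷⟩ (ϑ _) _ = ϑ≺⟨⟩ eq
head≺⟨∷⟩ ⟨ [] ⟩ _ = ⟨⟩≺⟨⟩ prefix
head≺⟨∷⟩ ⟨ c ∷ cs ⟩ _ = ⟨⟩≺⟨⟩ (here (head≺⟨∷⟩ c cs))

⪯-head⇒≺⟨∷⟩ : ∀ x {b bs} → x ⪯ b → x ≺ ⟨ b ∷ bs ⟩
⪯-head⇒≺⟨∷⟩ Ω p = Ω≺⟨⟩ p
⪯-head⇒≺⟨∷⟩ (ϑ _) p = ϑ≺⟨⟩ p
⪯-head⇒≺⟨∷⟩ ⟨ [] ⟩ _ = ⟨⟩≺⟨⟩ prefix
⪯-head⇒≺⟨∷⟩ ⟨ c ∷ cs ⟩ p = ⟨⟩≺⟨⟩ (here (≺-⪯-trans (head≺⟨∷⟩ c cs) p))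

⟨∷⟩-mono-⪯ : ∀ {a b as bs} → a ⪯ b → ⟨ as ⟩ ⪯ ⟨ bs ⟩ → ⟨ a ∷ as ⟩ ⪯ ⟨ b ∷ bs ⟩
⟨∷⟩-mono-⪯ (lt a≺b) _ = lt (⟨⟩≺⟨⟩ (here a≺b))
⟨∷⟩-mono-⪯ eq (lt (⟨⟩≺⟨⟩ as<bs)) = lt (⟨⟩≺⟨⟩ (there as<bs))
⟨∷⟩-mono-⪯ eq eq = eq

⊀Ω⇒Ω⪯ : ∀ x → ¬ x ≺ Ω → Ω ⪯ x
⊀Ω⇒Ω⪯ Ω _ = eq
⊀Ω⇒Ω⪯ (ϑ _) x⊀Ω = ⊥-elim (x⊀Ω ϑ≺Ω)
⊀Ω⇒Ω⪯ ⟨ [] ⟩ x⊀Ω = ⊥-elim (x⊀Ω []≺Ω)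
⊀Ω⇒Ω⪯ ⟨ a ∷ _ ⟩ x⊀Ω = lt (Ω≺⟨⟩ (⊀Ω⇒Ω⪯ a (x⊀Ω ∘ ∷≺Ω)))

Descending : List Term → Set
Descending = Linked (λ x y → y ⪯ x)

-- Positions are those of fs as, so that multiset embeddings between images of f can be read
-- on the underlying terms.
term-at : (as : List Term) → Fin (length (fs as)) → Term
term-at (a ∷ _) zero = a
term-at (_ ∷ as) (suc i) = term-at as i

lookup-fs : ∀ as i → lookup (fs as) i ≡ f (term-at as i)
lookup-fs (_ ∷ _) zero = refl
lookup-fs (_ ∷ as) (suc i) = lookup-fs as i

Any-fs⁻ : ∀ {P : T2 → Set} as → Any P (fs as) → ∃[ j ] P (f (term-at as j))
Any-fs⁻ {P} as p = index p , subst P (lookup-fs as (index p)) (lookup-index p)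

term-at-WF : ∀ {as} → All WF as → ∀ i → WF (term-at as i)
term-at-WF (w ∷ _) zero = w
term-at-WF (_ ∷ ws) (suc i) = term-at-WF ws i

term-at-⪯-head : ∀ {b bs} → Descending (b ∷ bs) → ∀ j → term-at (b ∷ bs) j ⪯ b
term-at-⪯-head _ zero = eq
term-at-⪯-head (c⪯b ∷ d) (suc j) = ⪯-trans (term-at-⪯-head d j) c⪯b

⟨⟩≺Ω⇒term-at≺Ω : ∀ {cs} → WF ⟨ cs ⟩ → ⟨ cs ⟩ ≺ Ω → ∀ j → term-at cs j ≺ Ω
⟨⟩≺Ω⇒term-at≺Ω (wf⟨⟩ _ d _) (∷≺Ω c≺Ω) j = ⪯-≺-trans (term-at-⪯-head d j) c≺Ω

mutual
  len : Term → ℕ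
  len Ω = 0
  len (ϑ a) = suc (len a)
  len ⟨ as ⟩ = lens as

  lens : List Term → ℕ
  lens [] = 0
  lens (a ∷ as) = suc (len a + lens as)

len-term-at : ∀ as i → len (term-at as i) < len ⟨ as ⟩
len-term-at (a ∷ as) zero = s≤s (m≤m+n (len a) (lens as))
len-term-at (a ∷ as) (suc i) = ≤-trans (len-term-at as i) (≤-trans (m≤n+m (lens as) (len a)) (n≤1+n _))

mutual
  len-∈E : ∀ {γ} b → γ ∈ E b → len γ ≤ len b
  len-∈E Ω ()
  len-∈E (ϑ _) (here refl) = ≤-refl
  len-∈E (ϑ _) (there ())
  len-∈E ⟨ as ⟩ γ∈ = len-∈Es as γ∈

  len-∈Es : ∀ {γ} as → γ ∈ Es as → len γ ≤ lens as
  len-∈Es [] ()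
  len-∈Es (a ∷ as) γ∈ with ∈-++⁻ (E a) γ∈
  ... | inj₁ γ∈a = ≤-trans (len-∈E a γ∈a) (≤-trans (m≤m+n (len a) (lens as)) (n≤1+n _))
  ... | inj₂ γ∈as = ≤-trans (len-∈Es as γ∈as) (≤-trans (m≤n+m (lens as) (len a)) (n≤1+n _))

mutual
  WF-∈E : ∀ {γ} b → WF b → γ ∈ E b → WF γ
  WF-∈E Ω _ ()
  WF-∈E (ϑ _) w (here refl) = w
  WF-∈E (ϑ _) _ (there ())
  WF-∈E ⟨ as ⟩ (wf⟨⟩ ws _ _) γ∈ = WF-∈Es as ws γ∈

  WF-∈Es : ∀ {γ} as → All WF as → γ ∈ Es as → WF γ
  WF-∈Es [] _ ()
  WF-∈Es (a ∷ as) (w ∷ ws) γ∈ with ∈-++⁻ (E a) γ∈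
  ... | inj₁ γ∈a = WF-∈E a w γ∈a
  ... | inj₂ γ∈as = WF-∈Es as ws γ∈as

mutual
  ∈E⇒ϑ : ∀ {γ} b → γ ∈ E b → ∃[ c ] γ ≡ ϑ c
  ∈E⇒ϑ Ω ()
  ∈E⇒ϑ (ϑ c) (here refl) = c , refl
  ∈E⇒ϑ (ϑ _) (there ())
  ∈E⇒ϑ ⟨ as ⟩ γ∈ = ∈Es⇒ϑ as γ∈

  ∈Es⇒ϑ : ∀ {γ} as → γ ∈ Es as → ∃[ c ] γ ≡ ϑ c
  ∈Es⇒ϑ [] ()
  ∈Es⇒ϑ (a ∷ as) γ∈ with ∈-++⁻ (E a) γ∈
  ... | inj₁ γ∈a = ∈E⇒ϑ a γ∈a
  ... | inj₂ γ∈as = ∈Es⇒ϑ as γ∈as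

box₁ : T2 → T2
box₁ t = suc zero ⋆ [ t ]

children : T2 → List T2
children (_ ⋆ σ) = σ

⊴-cases : ∀ {s t} → s ⊴ t → (r s ≡ r t × children s ⊴ᴹ children t) ⊎ Any (s ⊴_) (children t)
⊴-cases (⊴-node e m) = inj₁ (e , m)
⊴-cases (⊴-sub _ q) = inj₂ q

⊴-child : ∀ {s} t → r s ≤ᶠ r t → Any (s ⊴_) (children t) → s ⊴ t
⊴-child (_ ⋆ _) = ⊴-sub

r-mono : ∀ {s t} → s ⊴ t → r s ≤ᶠ r t
r-mono (⊴-node refl _) = ≤ᶠ-refl
r-mono (⊴-sub le _) = le

⊴-r≡0 : ∀ {s t} → s ⊴ t → r t ≡ zero → r s ≡ zero
⊴-r≡0 (⊴-node e _) refl = e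
⊴-r≡0 {zero ⋆ _} (⊴-sub _ _) refl = refl
⊴-r≡0 {suc zero ⋆ _} (⊴-sub () _) refl

⊴ᴹ-head : ∀ {s σ τ} → (s ∷ σ) ⊴ᴹ τ → Any (s ⊴_) τ
⊴ᴹ-head (inj g _ h) = lose (∈-lookup (g zero)) (h zero)

mutual
  ⊴-refl : ∀ t → t ⊴ t
  ⊴-refl (_ ⋆ σ) = ⊴-node refl (inj id id (lookup-⊴-refl σ))

  lookup-⊴-refl : ∀ σ i → lookup σ i ⊴ lookup σ i
  lookup-⊴-refl (t ∷ _) zero = ⊴-refl t
  lookup-⊴-refl (_ ∷ σ) (suc i) = lookup-⊴-refl σ i

mutual
  ⊴-trans : ∀ {s t u} → s ⊴ t → t ⊴ u → s ⊴ u
  ⊴-trans p (⊴-sub le q) = ⊴-sub (≤ᶠ-trans (r-mono p) le) (⊴-trans-Any p q)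
  ⊴-trans (⊴-node refl (inj g g-inj p)) (⊴-node refl (inj h h-inj q)) =
    ⊴-node refl (inj (h ∘ g) (g-inj ∘ h-inj) (λ i → ⊴-trans (p i) (q (g i))))
  ⊴-trans (⊴-sub le p) (⊴-node refl (inj h _ q)) =
    ⊴-sub le (lose (∈-lookup (h (index p))) (⊴-trans (lookup-index p) (q (index p))))

  ⊴-trans-Any : ∀ {s t ts} → s ⊴ t → Any (t ⊴_) ts → Any (s ⊴_) ts
  ⊴-trans-Any p (here q) = here (⊴-trans p q)
  ⊴-trans-Any p (there q) = there (⊴-trans-Any p q)

⊴-box₁ : ∀ s → s ⊴ box₁ s
⊴-box₁ s = ⊴-sub (≤fromℕ (r s)) (here (⊴-refl s))

box₁-⊴⁻ : ∀ {s t} → box₁ s ⊴ box₁ t → s ⊴ t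
box₁-⊴⁻ (⊴-node _ m) = singleton⁻ (⊴ᴹ-head m)
box₁-⊴⁻ (⊴-sub _ q) = ⊴-trans (⊴-box₁ _) (singleton⁻ q)

⊴-box₁⁻ : ∀ {s t} → r s ≡ zero → s ⊴ box₁ t → s ⊴ t
⊴-box₁⁻ () (⊴-node refl _)
⊴-box₁⁻ _ (⊴-sub _ q) = singleton⁻ q

mutual
  height : T2 → ℕ
  height (_ ⋆ σ) = suc (max-height σ)

  max-height : List T2 → ℕ
  max-height [] = 0
  max-height (t ∷ σ) = height t ⊔ max-height σ

height-lookup : ∀ τ j → height (lookup τ j) ≤ max-height τ
height-lookup (t ∷ τ) zero = m≤m⊔n (height t) (max-height τ)
height-lookup (t ∷ τ) (suc j) = ≤-trans (height-lookup τ j) (m≤n⊔m (height t) (max-height τ))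

max-height-mono : ∀ σ τ (g : Fin (length σ) → Fin (length τ)) →
  (∀ i → height (lookup σ i) ≤ height (lookup τ (g i))) → max-height σ ≤ max-height τ
max-height-mono [] _ _ _ = z≤n
max-height-mono (_ ∷ σ) τ g le =
  ⊔-lub (≤-trans (le zero) (height-lookup τ (g zero))) (max-height-mono σ τ (g ∘ suc) (le ∘ suc))

mutual
  height-mono : ∀ {s t} → s ⊴ t → height s ≤ height t
  height-mono (⊴-node {σ = σ} {τ} _ (inj g _ p)) = s≤s (max-height-mono σ τ g (height-mono ∘ p))
  height-mono (⊴-sub _ q) = ≤-trans (height-mono-Any q) (n≤1+n _)

  height-mono-Any : ∀ {s ts} → Any (s ⊴_) ts → height s ≤ max-height ts
  height-mono-Any {ts = t ∷ ts} (here p) = ≤-trans (height-mono p) (m≤m⊔n (height t) (max-height ts))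
  height-mono-Any {ts = t ∷ ts} (there q) = ≤-trans (height-mono-Any q) (m≤n⊔m (height t) (max-height ts))

f-ϑ⋬f : ∀ b → ¬ f (ϑ b) ⊴ f b
f-ϑ⋬f b p = <⇒≱ (s≤s (≤-trans (m≤m⊔n _ 0) (≤-trans (n≤1+n _) (m≤m⊔n _ 0)))) (height-mono p)

≺Ω⇒r-f≡0 : ∀ {x} → x ≺ Ω → r (f x) ≡ zero
≺Ω⇒r-f≡0 ϑ≺Ω = refl
≺Ω⇒r-f≡0 []≺Ω = refl
≺Ω⇒r-f≡0 (∷≺Ω {a} a≺Ω) with a ≺Ω?
... | yes _ = refl
... | no a⊀Ω = ⊥-elim (a⊀Ω a≺Ω)

r-f≡0⇒≺Ω : ∀ x → r (f x) ≡ zero → x ≺ Ω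
r-f≡0⇒≺Ω Ω ()
r-f≡0⇒≺Ω (ϑ _) _ = ϑ≺Ω
r-f≡0⇒≺Ω ⟨ [] ⟩ _ = []≺Ω
r-f≡0⇒≺Ω ⟨ a ∷ as ⟩ e with a ≺Ω?
... | yes a≺Ω = ∷≺Ω a≺Ω
r-f≡0⇒≺Ω ⟨ a ∷ as ⟩ () | no _

children-f⟨⟩ : ∀ as → children (f ⟨ as ⟩) ≡ fs as
children-f⟨⟩ [] = refl
children-f⟨⟩ (a ∷ _) with a ≺Ω?
... | yes _ = refl
... | no _ = refl

⊴-f⟨⟩ : ∀ {s} as → r s ≤ᶠ r (f ⟨ as ⟩) → Any (s ⊴_) (fs as) → s ⊴ f ⟨ as ⟩
⊴-f⟨⟩ as le q = ⊴-child (f ⟨ as ⟩) le (subst (Any _) (sym (children-f⟨⟩ as)) q)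

f-head⊴ : ∀ a as → f a ⊴ f ⟨ a ∷ as ⟩
f-head⊴ a as with a ≺Ω?
... | yes a≺Ω = ⊴-sub (≤ᶠ-reflexive (≺Ω⇒r-f≡0 a≺Ω)) (here (⊴-refl (f a)))
... | no _ = ⊴-sub (≤fromℕ (r (f a))) (here (⊴-refl (f a)))

⊴-f-ϑ : ∀ c b → f (ϑ c) ⊴ f b → f (ϑ c) ⊴ f (ϑ b)
⊴-f-ϑ _ _ p = ⊴-sub z≤n (here (⊴-sub z≤n (here p)))

mutual
  f-∈E-⊴ : ∀ {γ} b → γ ∈ E b → f γ ⊴ f b
  f-∈E-⊴ Ω ()
  f-∈E-⊴ (ϑ a) (here refl) = ⊴-refl (f (ϑ a))
  f-∈E-⊴ (ϑ _) (there ())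
  f-∈E-⊴ ⟨ as ⟩ γ∈ with ∈E⇒ϑ ⟨ as ⟩ γ∈
  ... | _ , refl = ⊴-f⟨⟩ as z≤n (f-∈Es-⊴ as γ∈)

  f-∈Es-⊴ : ∀ {γ} as → γ ∈ Es as → Any (f γ ⊴_) (fs as)
  f-∈Es-⊴ [] ()
  f-∈Es-⊴ (a ∷ as) γ∈ with ∈-++⁻ (E a) γ∈
  ... | inj₁ γ∈a = here (f-∈E-⊴ a γ∈a)
  ... | inj₂ γ∈as = there (f-∈Es-⊴ as γ∈as)

-- The children of f ⟨ cs ⟩ all have label 0 here, while box₁ (f a) has label 1.
f-ϑ-⋬ᴹ-f⟨⟩ : ∀ a cs → WF ⟨ cs ⟩ → r (f ⟨ cs ⟩) ≡ zero → ¬ (children (f (ϑ a)) ⊴ᴹ children (f ⟨ cs ⟩))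
f-ϑ-⋬ᴹ-f⟨⟩ _ cs w e m with Any-fs⁻ cs (subst (Any _) (children-f⟨⟩ cs) (⊴ᴹ-head m))
... | j , q with ⊴-r≡0 q (≺Ω⇒r-f≡0 (⟨⟩≺Ω⇒term-at≺Ω w (r-f≡0⇒≺Ω ⟨ cs ⟩ e) j))
... | ()

mutual
  f-ϑ⊴⇒Any-E : ∀ a b → WF b → f (ϑ a) ⊴ f b → Any (λ γ → f (ϑ a) ⊴ f γ) (E b)
  f-ϑ⊴⇒Any-E _ Ω _ (⊴-node () _)
  f-ϑ⊴⇒Any-E _ Ω _ (⊴-sub _ ())
  f-ϑ⊴⇒Any-E _ (ϑ _) _ p = here p
  f-ϑ⊴⇒Any-E a ⟨ cs ⟩ w p with ⊴-cases p
  ... | inj₁ (e , m) = ⊥-elim (f-ϑ-⋬ᴹ-f⟨⟩ a cs w (sym e) m)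
  f-ϑ⊴⇒Any-E a ⟨ cs ⟩ (wf⟨⟩ ws _ _) p | inj₂ q =
    f-ϑ⊴⇒Any-Es a cs ws (subst (Any _) (children-f⟨⟩ cs) q)

  f-ϑ⊴⇒Any-Es : ∀ a cs → All WF cs → Any (f (ϑ a) ⊴_) (fs cs) → Any (λ γ → f (ϑ a) ⊴ f γ) (Es cs)
  f-ϑ⊴⇒Any-Es a (c ∷ _) (w ∷ _) (here p) = ++⁺ˡ (f-ϑ⊴⇒Any-E a c w p)
  f-ϑ⊴⇒Any-Es a (c ∷ cs) (_ ∷ ws) (there q) = ++⁺ʳ (E c) (f-ϑ⊴⇒Any-Es a cs ws q)

tail-index : ∀ {n} (j i : Fin (suc n)) → j ≢ i → Fin n
tail-index zero zero j≢i = ⊥-elim (j≢i refl)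
tail-index zero (suc i) _ = i
tail-index (suc j) _ _ = j

tail-index-cases : ∀ {n} (j i : Fin (suc n)) (j≢i : j ≢ i) →
  j ≡ suc (tail-index j i j≢i) ⊎ i ≡ suc (tail-index j i j≢i)
tail-index-cases zero zero j≢i = ⊥-elim (j≢i refl)
tail-index-cases zero (suc _) _ = inj₂ refl
tail-index-cases (suc _) _ _ = inj₁ refl

tail-index-injective : ∀ {n} (j₁ j₂ i : Fin (suc n)) (j₁≢i : j₁ ≢ i) (j₂≢i : j₂ ≢ i) →
  tail-index j₁ i j₁≢i ≡ tail-index j₂ i j₂≢i → j₁ ≡ j₂
tail-index-injective zero zero _ _ _ _ = refl
tail-index-injective (suc _) (suc _) _ _ _ e = cong suc e
tail-index-injective zero (suc _) zero j₁≢i _ _ = ⊥-elim (j₁≢i refl)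
tail-index-injective zero (suc _) (suc _) _ j₂≢i e = ⊥-elim (j₂≢i (cong suc (sym e)))
tail-index-injective (suc _) zero zero _ j₂≢i _ = ⊥-elim (j₂≢i refl)
tail-index-injective (suc _) zero (suc _) j₁≢i _ e = ⊥-elim (j₁≢i (cong suc e))

-- On the tails, the component that g sends to the head of bs is redirected to g zero, the
-- target freed by the head of as; it fits there because it is ⪯ the head of as.
⪯-injection⇒⪯ : ∀ as bs → Descending as → Descending bs →
  (g : Fin (length (fs as)) → Fin (length (fs bs))) → Injective _≡_ _≡_ g →
  (∀ i → term-at as i ⪯ term-at bs (g i)) → ⟨ as ⟩ ⪯ ⟨ bs ⟩
⪯-injection⇒⪯ [] bs _ _ _ _ _ = ⟨⟩-least ⟨ bs ⟩
⪯-injection⇒⪯ (_ ∷ _) [] _ _ g _ _ with g zero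
... | ()
⪯-injection⇒⪯ (a ∷ as) (b ∷ bs) das dbs g g-inj a⪯b =
  ⟨∷⟩-mono-⪯ (⪯-trans (a⪯b zero) (term-at-⪯-head dbs (g zero)))
             (⪯-injection⇒⪯ as bs (tail das) (tail dbs) g′ g′-inj a⪯b′)
  where
  g-suc≢g-zero : ∀ k → g (suc k) ≢ g zero
  g-suc≢g-zero k e with g-inj e
  ... | ()

  g′ : Fin (length (fs as)) → Fin (length (fs bs))
  g′ k = tail-index (g (suc k)) (g zero) (g-suc≢g-zero k)

  g′-inj : Injective _≡_ _≡_ g′
  g′-inj {k₁} {k₂} e =
    suc-injective (g-inj (tail-index-injective _ _ _ (g-suc≢g-zero k₁) (g-suc≢g-zero k₂) e))

  a⪯b′ : ∀ k → term-at as k ⪯ term-at bs (g′ k)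
  a⪯b′ k with tail-index-cases (g (suc k)) (g zero) (g-suc≢g-zero k)
  ... | inj₁ e = subst (λ j → term-at as k ⪯ term-at (b ∷ bs) j) e (a⪯b (suc k))
  ... | inj₂ e = ⪯-trans (term-at-⪯-head das (suc k)) (subst (λ j → a ⪯ term-at (b ∷ bs) j) e (a⪯b zero))

Reflects : Term → Term → Set
Reflects α β = WF α → WF β → f α ⊴ f β → α ⪯ β

Below : ℕ → Set
Below n = ∀ α β → len α + len β < n → Reflects α β

Below-mono : ∀ {m n} → m ≤ n → Below n → Below m
Below-mono m≤n ih α β l = ih α β (<-≤-trans l m≤n)

≺Ω-⊴⇒≺ϑ : ∀ x b → Below (len x + len (ϑ b)) → WF x → WF b → x ≺ Ω → f x ⊴ f b → x ≺ ϑ b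
≺Ω-⊴⇒≺ϑ (ϑ c) b ih wx wb _ p with find (f-ϑ⊴⇒Any-E c b wb p)
... | γ , γ∈ , q =
  ϑ≺ϑ₂ (lose γ∈ (ih (ϑ c) γ (+-monoʳ-< (len (ϑ c)) (s≤s (len-∈E b γ∈))) wx (WF-∈E b wb γ∈) q))
≺Ω-⊴⇒≺ϑ ⟨ [] ⟩ _ _ _ _ _ _ = []≺ϑ
≺Ω-⊴⇒≺ϑ ⟨ c ∷ cs ⟩ b ih (wf⟨⟩ (wc ∷ _) _ _) wb (∷≺Ω c≺Ω) p =
  ∷≺ϑ (≺Ω-⊴⇒≺ϑ c b ih′ wc wb c≺Ω (⊴-trans (f-head⊴ c cs) p))
  where
  ih′ : Below (len c + len (ϑ b))
  ih′ = Below-mono (+-monoˡ-≤ (len (ϑ b)) (<⇒≤ (len-term-at (c ∷ cs) zero))) ih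

ϑ-reflect : ∀ a b → Below (len (ϑ a) + len (ϑ b)) → WF a → WF b → f a ⊴ f b → ϑ a ⪯ ϑ b
ϑ-reflect a b ih wa wb q with ih a b (+-mono-< (n<1+n (len a)) (n<1+n (len b))) wa wb q
... | eq = eq
... | lt a≺b = lt (ϑ≺ϑ₁ a≺b (All.tabulate E-below))
  where
  ⪯ϑ-⊴⇒≺ϑ : ∀ {γ} → γ ⪯ ϑ b → f γ ⊴ f b → γ ≺ ϑ b
  ⪯ϑ-⊴⇒≺ϑ (lt γ≺ϑb) _ = γ≺ϑb
  ⪯ϑ-⊴⇒≺ϑ eq p = ⊥-elim (f-ϑ⋬f b p)

  E-below : ∀ {γ} → γ ∈ E a → γ ≺ ϑ b
  E-below γ∈ with ∈E⇒ϑ a γ∈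
  ... | c , refl = ⪯ϑ-⊴⇒≺ϑ (ih (ϑ c) (ϑ b) bound (WF-∈E a wa γ∈) (wfϑ wb) (⊴-f-ϑ c b γ⊴b)) γ⊴b
    where
    γ⊴b = ⊴-trans (f-∈E-⊴ a γ∈) q
    bound = +-monoˡ-< (len (ϑ b)) (s≤s (len-∈E a γ∈))

child-⊴⇒≺ : ∀ α β → Below (len α + len β) → WF α → WF β →
  f α ⊴ f β → Any (f α ⊴_) (children (f β)) → α ≺ β
child-⊴⇒≺ α (ϑ b) ih wα (wfϑ wb) p q =
  ≺Ω-⊴⇒≺ϑ α b ih wα wb (r-f≡0⇒≺Ω α (⊴-r≡0 p refl)) (⊴-box₁⁻ (⊴-r≡0 p refl) (singleton⁻ q))
child-⊴⇒≺ α ⟨ b ∷ bs ⟩ ih wα (wf⟨⟩ ws d _) _ q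
  with Any-fs⁻ (b ∷ bs) (subst (Any _) (children-f⟨⟩ (b ∷ bs)) q)
... | j , q′ = ⪯-head⇒≺⟨∷⟩ α (⪯-trans α⪯bj (term-at-⪯-head d j))
  where
  α⪯bj = ih α (term-at (b ∷ bs) j) (+-monoʳ-< (len α) (len-term-at (b ∷ bs) j)) wα (term-at-WF ws j) q′

node-ϑ-reflect : ∀ a β → Below (len (ϑ a) + len β) → WF a → WF β →
  r (f β) ≡ zero → children (f (ϑ a)) ⊴ᴹ children (f β) → ϑ a ⪯ β
node-ϑ-reflect _ Ω _ _ _ () _
node-ϑ-reflect a (ϑ b) ih wa (wfϑ wb) _ m = ϑ-reflect a b ih wa wb (box₁-⊴⁻ (singleton⁻ (⊴ᴹ-head m)))
node-ϑ-reflect a ⟨ bs ⟩ _ _ wβ e m = ⊥-elim (f-ϑ-⋬ᴹ-f⟨⟩ a bs wβ e m)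

node-⟨∷⟩-reflect : ∀ a as β → Below (len ⟨ a ∷ as ⟩ + len β) → WF ⟨ a ∷ as ⟩ → WF β →
  r (f ⟨ a ∷ as ⟩) ≡ r (f β) → children (f ⟨ a ∷ as ⟩) ⊴ᴹ children (f β) → ⟨ a ∷ as ⟩ ⪯ β
node-⟨∷⟩-reflect a as Ω _ _ _ _ m with ⊴ᴹ-head (subst (_⊴ᴹ []) (children-f⟨⟩ (a ∷ as)) m)
... | ()
node-⟨∷⟩-reflect a as (ϑ b) ih (wf⟨⟩ (wa ∷ _) _ _) (wfϑ wb) e m with r-f≡0⇒≺Ω ⟨ a ∷ as ⟩ e
... | ∷≺Ω a≺Ω = lt (∷≺ϑ (≺Ω-⊴⇒≺ϑ a b ih′ wa wb a≺Ω (⊴-box₁⁻ (≺Ω⇒r-f≡0 a≺Ω) (singleton⁻ a⊴))))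
  where
  a⊴ = ⊴ᴹ-head (subst (_⊴ᴹ _) (children-f⟨⟩ (a ∷ as)) m)
  ih′ : Below (len a + len (ϑ b))
  ih′ = Below-mono (+-monoˡ-≤ (len (ϑ b)) (<⇒≤ (len-term-at (a ∷ as) zero))) ih
node-⟨∷⟩-reflect a as ⟨ bs ⟩ ih (wf⟨⟩ was das _) (wf⟨⟩ wbs dbs _) _ m
  with subst₂ _⊴ᴹ_ (children-f⟨⟩ (a ∷ as)) (children-f⟨⟩ bs) m
... | inj g g-inj h = ⪯-injection⇒⪯ (a ∷ as) bs das dbs g g-inj pointwise
  where
  pointwise : ∀ i → term-at (a ∷ as) i ⪯ term-at bs (g i)
  pointwise i =
    ih (term-at (a ∷ as) i) (term-at bs (g i))
       (+-mono-< (len-term-at (a ∷ as) i) (len-term-at bs (g i)))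
       (term-at-WF was i) (term-at-WF wbs (g i))
       (subst₂ _⊴_ (lookup-fs (a ∷ as) i) (lookup-fs bs (g i)) (h i))

reflects-step : ∀ α β → Below (len α + len β) → Reflects α β
reflects-step Ω β _ _ _ p = ⊀Ω⇒Ω⪯ β (λ β≺Ω → 0≢1+n (sym (⊴-r≡0 p (≺Ω⇒r-f≡0 β≺Ω))))
reflects-step ⟨ [] ⟩ β _ _ _ _ = ⟨⟩-least β
reflects-step (ϑ a) β ih wα@(wfϑ wa) wβ p with ⊴-cases p
... | inj₁ (e , m) = node-ϑ-reflect a β ih wa wβ (sym e) m
... | inj₂ q = lt (child-⊴⇒≺ (ϑ a) β ih wα wβ p q)
reflects-step ⟨ a ∷ as ⟩ β ih wα wβ p with ⊴-cases p
... | inj₁ (e , m) = node-⟨∷⟩-reflect a as β ih wα wβ e m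
... | inj₂ q = lt (child-⊴⇒≺ ⟨ a ∷ as ⟩ β ih wα wβ p q)

reflects : ∀ α β → Acc _<_ (len α + len β) → Reflects α β
reflects α β (acc rs) = reflects-step α β (λ α′ β′ l → reflects α′ β′ (rs l))

theorem3p6 : (α β : Term) → WF α → WF β → f α ⊴ f β → α ⪯ β
theorem3p6 α β = reflects α β (<-wellFounded _)
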